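{- Let $\mathcal{C}$ be a sum closed, rc-invariant permutation class. Let $a_n=|\mathcal{C}_n|$, $b_n=|\mathcal{C}^{rc}_{2n}|$, and let $d_n$ be the number of centrosymmetric sum-indecomposable permutations of size $2n$ in $\mathcal{C}$. With $A(x)=\sum_{n\ge0}a_nx^n$, $B(x)=\sum_{n\ge0}b_nx^n$ and $D(x)=\sum_{n\ge1}d_nx^n$, we have the identity of formal power series $B(x)=(1+D(x))\,A(x)$.
   Context: A permutation of size $n$ is a bijection of $[n]$ (size $0$: the empty permutation); a permutation class is a set of permutations closed downward under pattern containment; $\mathcal{C}_n$ is its set of size-$n$ elements. For $\pi$ of size $n$, $\mathrm{rc}(\pi)(i)=n+1-\pi(n+1-i)$; $\pi$ is centrosymmetric if $\mathrm{rc}(\pi)=\pi$; $\mathcal{C}^{rc}_n$ is the set of centrosymmetric elements of $\mathcal{C}_n$; $\mathcal{C}$ is rc-invariant if $\mathrm{rc}(\mathcal{C})=\mathcal{C}$. The sum $\sigma\oplus\tau$ of $\sigma$ (size $a$) and $\tau$ (size $b$) is given by $(\sigma\oplus\tau)(i)=\sigma(i)$ for $i\le a$ and $a+\tau(i-a)$ for $i>a$; $\mathcal{C}$ is sum closed if it is closed under $\oplus$. A permutation is sum-indecomposable if it is not $\sigma\oplus\tau$ with $\sigma,\tau$ both of nonzero size. -}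

module Defs where

open import Data.Nat using (ℕ; zero; suc; _+_; _*_; _∸_; _≤_; _<_)
open import Data.Fin using (Fin; opposite; _↑ˡ_; _↑ʳ_)
import Data.Fin as F
open import Data.Vec using (Vec; []; _∷_; lookup; tabulate; map; _++_)
open import Data.List using (List; allFin; concatMap)
import Data.List as L
open import Data.Product using (Σ; ∃; ∃-syntax; _×_; _,_; proj₁)
open import Relation.Binary.PropositionalEquality using (_≡_)
open import Relation.Nullary using (¬_)
open import Function.Bundles using (_⇔_)

-- Permutations (one-line notation, 0-indexed).

Perm : Set
Perm = Σ ℕ (λ n → Vec (Fin n) n)

size : Perm → ℕ
size = proj₁

IsPerm : Perm → Set
IsPerm (n , v) = ∀ i j → lookup v i ≡ lookup v j → i ≡ j

_≼_ : Perm → Perm → Set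
(k , σ) ≼ (n , π) =
  Σ (Fin k → Fin n) λ f →
    (∀ i j → i F.< j → f i F.< f j) ×
    (∀ i j → (lookup σ i F.< lookup σ j) ⇔ (lookup π (f i) F.< lookup π (f j)))

-- reverse-complement: rc(π)(i) = n+1-π(n+1-i)  (0-indexed: opposite ∘ π ∘ opposite)
rc : Perm → Perm
rc (n , v) = n , tabulate (λ i → opposite (lookup v (opposite i)))

Centrosymmetric : Perm → Set
Centrosymmetric π = rc π ≡ π

_⊕_ : Perm → Perm → Perm
(a , σ) ⊕ (b , τ) = a + b , (map (_↑ˡ b) σ ++ map (a ↑ʳ_) τ)

SumIndecomposable : Perm → Set
SumIndecomposable π =
  ¬ (Σ Perm λ σ → Σ Perm λ τ →
       1 ≤ size σ × 1 ≤ size τ × π ≡ σ ⊕ τ)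

record IsPermClass (C : Perm → Set) : Set where
  field
    onlyPerms : ∀ π → C π → IsPerm π
    downClosed : ∀ σ π → IsPerm σ → σ ≼ π → C π → C σ

SumClosed : (Perm → Set) → Set
SumClosed C = ∀ σ τ → C σ → C τ → C (σ ⊕ τ)

-- rc(C) = C, as two inclusions
RcInvariant : (Perm → Set) → Set
RcInvariant C =
  (∀ π → C π → C (rc π)) × (∀ π → C π → Σ Perm λ π′ → C π′ × rc π′ ≡ π)

allVecs : (k n : ℕ) → List (Vec (Fin n) k)
allVecs zero n = [] L.∷ L.[]
allVecs (suc k) n = concatMap (λ x → L.map (x ∷_) (allVecs k n)) (allFin n)

data Count {A : Set} (P : A → Set) : List A → ℕ → Set where
  c-nil  : Count P L.[] 0
  c-yes  : ∀ {x xs m} → P x → Count P xs m → Count P (x L.∷ xs) (suc m)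
  c-no   : ∀ {x xs m} → ¬ P x → Count P xs m → Count P (x L.∷ xs) m

CardOfSize : (Perm → Set) → ℕ → ℕ → Set
CardOfSize P n m = Count (λ v → P (n , v)) (allVecs n n) m

-- Formal power series over ℕ as coefficient sequences, Cauchy product

sumUpTo : ℕ → (ℕ → ℕ) → ℕ
sumUpTo zero f = f zero
sumUpTo (suc n) f = sumUpTo n f + f (suc n)

_⊛_ : (ℕ → ℕ) → (ℕ → ℕ) → (ℕ → ℕ)
(f ⊛ g) n = sumUpTo n (λ i → f i * g (n ∸ i))

-- 1 + D(x) where D(x) = Σ_{n≥1} d n xⁿ
onePlus : (ℕ → ℕ) → (ℕ → ℕ)
onePlus d zero = 1
onePlus d (suc n) = d (suc n)

-- A centrosymmetric π ∈ C of size 2n factors uniquely as α ⊕ γ ⊕ rc α, where s = size α is the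
-- largest split point of π not exceeding n. Centrosymmetry mirrors split points (s ↦ 2n − s), so
-- the middle block γ has size 2(n − s) and is itself centrosymmetric; it is empty when π splits at
-- n, and otherwise has no proper split point, i.e. it is sum-indecomposable. Conversely, sum
-- closure and rc-invariance glue any α ∈ C of size n − i and any such γ of size 2i into an element
-- of C^rc of size 2n. Counting the pairs (γ, α) gives b n = Σᵢ (1 + D)ᵢ a (n − i).

module Submission where

open import Defs
open import Data.Bool using (Bool; true; T)
open import Data.Bool.Properties using (T-irrelevant)
open import Data.Empty using (⊥-elim)
open import Data.Fin as F using (Fin; toℕ; fromℕ<; opposite; _↑ˡ_; _↑ʳ_)
import Data.Fin.Properties as FP
open import Data.Fin.Permutation using (↔⇒≡)
open import Data.List as L using (List; allFin; concatMap)
open import Data.List.Membership.Propositional using (_∈_; lose)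
open import Data.List.Membership.Propositional.Properties using (∈-allFin; ∈-map⁺; ∈-concatMap⁺)
open import Data.List.Relation.Unary.Any using (here; there)
open import Data.Nat
open import Data.Nat.Properties
open import Data.Nat.Tactic.RingSolver using (solve-∀)
open import Data.Product using (Σ; ∃; ∃₂; _×_; _,_; proj₁; proj₂)
open import Data.Product.Function.NonDependent.Propositional using (_×-↔_)
import Data.Product.Properties as PP
open import Data.Sum using (_⊎_; inj₁; inj₂; [_,_]′)
open import Data.Sum.Function.Propositional using (_⊎-↔_)
open import Data.Unit using (tt)
open import Data.Vec using (Vec; []; _∷_; lookup; tabulate; map; _++_)
import Data.Vec.Properties as VP
open import Function.Base using (_∘_)
open import Function.Bundles using (_↔_; _⇔_; mk↔ₛ′; mk⇔; Equivalence)
open import Function.Properties.Inverse using (↔-sym; ↔-trans)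
open import Relation.Binary.Definitions using (tri<; tri≈; tri>)
open import Relation.Binary.PropositionalEquality
open import Relation.Nullary using (¬_; Dec; yes; no; ¬?; _×-dec_; _→-dec_)
open import Relation.Nullary.Decidable using (⌊_⌋; toWitness; fromWitness)

Card : Set → ℕ → Set
Card A m = Fin m ↔ A

card-unique : ∀ {A m n} → Card A m → Card A n → m ≡ n
card-unique c c′ = ↔⇒≡ (↔-trans c (↔-sym c′))

card-⊎ : ∀ {A B m n} → Card A m → Card B n → Card (A ⊎ B) (m + n)
card-⊎ c d = ↔-trans FP.+↔⊎ (c ⊎-↔ d)

card-× : ∀ {A B m n} → Card A m → Card B n → Card (A × B) (m * n)
card-× c d = ↔-trans FP.*↔× (c ×-↔ d)

card-empty : ∀ {A} → ¬ A → Card A 0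
card-empty ¬a = mk↔ₛ′ (λ ()) (⊥-elim ∘ ¬a) (⊥-elim ∘ ¬a) (λ ())

card-singleton : ∀ {A} (a : A) → (∀ x → x ≡ a) → Card A 1
card-singleton a unique = mk↔ₛ′ (λ _ → a) (λ _ → F.zero) (sym ∘ unique) (λ { F.zero → refl ; (F.suc ()) })

Σ-Fin-suc : ∀ {n} (S : Fin (suc n) → Set) →
  (S F.zero ⊎ Σ (Fin n) (S ∘ F.suc)) ↔ Σ (Fin (suc n)) S
Σ-Fin-suc S = mk↔ₛ′
  (λ { (inj₁ x) → F.zero , x ; (inj₂ (j , x)) → F.suc j , x })
  (λ { (F.zero , x) → inj₁ x ; (F.suc j , x) → inj₂ (j , x) })
  (λ { (F.zero , x) → refl ; (F.suc j , x) → refl })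
  (λ { (inj₁ x) → refl ; (inj₂ (j , x)) → refl })

Σ≤-suc : ∀ (S : ℕ → Set) n →
  ((Σ ℕ λ i → i ≤ n × S i) ⊎ S (suc n)) ↔ (Σ ℕ λ i → i ≤ suc n × S i)
Σ≤-suc S n = mk↔ₛ′ to from to∘from from∘to
  where
  to : (Σ ℕ λ i → i ≤ n × S i) ⊎ S (suc n) → Σ ℕ λ i → i ≤ suc n × S i
  to (inj₁ (i , i≤n , x)) = i , m≤n⇒m≤1+n i≤n , x
  to (inj₂ x) = suc n , ≤-refl , x
  from : (Σ ℕ λ i → i ≤ suc n × S i) → (Σ ℕ λ i → i ≤ n × S i) ⊎ S (suc n)
  from (i , i≤1+n , x) with m≤n⇒m<n∨m≡n i≤1+n
  ... | inj₁ i<1+n = inj₁ (i , s≤s⁻¹ i<1+n , x)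
  ... | inj₂ refl = inj₂ x
  to∘from : ∀ y → to (from y) ≡ y
  to∘from (i , i≤1+n , x) with m≤n⇒m<n∨m≡n i≤1+n
  ... | inj₁ _ = cong (λ p → i , p , x) (≤-irrelevant _ _)
  ... | inj₂ refl = cong (λ p → suc n , p , x) (≤-irrelevant _ _)
  from∘to : ∀ x → from (to x) ≡ x
  from∘to (inj₁ (i , i≤n , x)) with m≤n⇒m<n∨m≡n (m≤n⇒m≤1+n i≤n)
  ... | inj₁ _ = cong (λ p → inj₁ (i , p , x)) (≤-irrelevant _ _)
  ... | inj₂ refl = ⊥-elim (<-irrefl refl i≤n)
  from∘to (inj₂ x) with m≤n⇒m<n∨m≡n (≤-refl {suc n})
  ... | inj₁ 1+n<1+n = ⊥-elim (<-irrefl refl 1+n<1+n)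
  ... | inj₂ refl = refl

card-Σ≤ : ∀ (S : ℕ → Set) (f : ℕ → ℕ) n → (∀ {i} → i ≤ n → Card (S i) (f i)) →
  Card (Σ ℕ λ i → i ≤ n × S i) (sumUpTo n f)
card-Σ≤ S f zero card-S = ↔-trans (card-S z≤n)
  (mk↔ₛ′ (λ x → 0 , z≤n , x) (λ { (.0 , z≤n , x) → x }) (λ { (.0 , z≤n , x) → refl }) (λ _ → refl))
card-Σ≤ S f (suc n) card-S =
  ↔-trans (card-⊎ (card-Σ≤ S f n (card-S ∘ m≤n⇒m≤1+n)) (card-S ≤-refl)) (Σ≤-suc S n)

count-cong : ∀ {A : Set} {P Q : A → Set} {xs m} →
  (∀ {x} → P x → Q x) → (∀ {x} → Q x → P x) → Count P xs m → Count Q xs m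
count-cong P⇒Q Q⇒P c-nil = c-nil
count-cong P⇒Q Q⇒P (c-yes p c) = c-yes (P⇒Q p) (count-cong P⇒Q Q⇒P c)
count-cong P⇒Q Q⇒P (c-no ¬p c) = c-no (¬p ∘ Q⇒P) (count-cong P⇒Q Q⇒P c)

count-map : ∀ {A B : Set} {P : B → Set} (f : A → B) xs {m} →
  Count P (L.map f xs) m → Count (P ∘ f) xs m
count-map f L.[] c-nil = c-nil
count-map f (x L.∷ xs) (c-yes p c) = c-yes p (count-map f xs c)
count-map f (x L.∷ xs) (c-no ¬p c) = c-no ¬p (count-map f xs c)

count-++ : ∀ {A : Set} {P : A → Set} xs {ys m} → Count P (xs L.++ ys) m →
  ∃₂ λ m₁ m₂ → m ≡ m₁ + m₂ × Count P xs m₁ × Count P ys m₂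
count-++ L.[] c = 0 , _ , refl , c-nil , c
count-++ (x L.∷ xs) (c-yes p c) =
  let m₁ , m₂ , m≡ , c₁ , c₂ = count-++ xs c in suc m₁ , m₂ , cong suc m≡ , c-yes p c₁ , c₂
count-++ (x L.∷ xs) (c-no ¬p c) =
  let m₁ , m₂ , m≡ , c₁ , c₂ = count-++ xs c in m₁ , m₂ , m≡ , c-no ¬p c₁ , c₂

count-dec : ∀ {A : Set} {P : A → Set} {xs m x} → Count P xs m → x ∈ xs → Dec (P x)
count-dec (c-yes p _) (here refl) = yes p
count-dec (c-no ¬p _) (here refl) = no ¬p
count-dec (c-yes _ c) (there x∈xs) = count-dec c x∈xs
count-dec (c-no _ c) (there x∈xs) = count-dec c x∈xs

∈-allVecs : ∀ {k N} (v : Vec (Fin N) k) → v ∈ allVecs k N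
∈-allVecs [] = here refl
∈-allVecs {suc k} {N} (x ∷ v) =
  ∈-concatMap⁺ (λ y → L.map (y ∷_) (allVecs k N)) (lose (∈-allFin x) (∈-map⁺ (x ∷_) (∈-allVecs v)))

count-concatMap-tabulate : ∀ {N B} {P : B → Set} (g : Fin N → List B) (S : Fin N → Set) →
  (∀ x {m} → Count P (g x) m → Card (S x) m) →
  ∀ {n} (h : Fin n → Fin N) {m} → Count P (concatMap g (L.tabulate h)) m →
  Card (Σ (Fin n) (S ∘ h)) m
count-concatMap-tabulate g S card-g {zero} h c-nil = card-empty λ ()
count-concatMap-tabulate g S card-g {suc n} h c with count-++ (g (h F.zero)) c
... | _ , _ , refl , c₁ , c₂ = ↔-trans (card-⊎ (card-g (h F.zero) c₁) (count-concatMap-tabulate g S card-g (h ∘ F.suc) c₂))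
    (Σ-Fin-suc (S ∘ h))

count-allVecs : ∀ k {N} (q : Vec (Fin N) k → Bool) {m} →
  Count (T ∘ q) (allVecs k N) m → Card (Σ (Vec (Fin N) k) (T ∘ q)) m
count-allVecs zero q (c-yes t c-nil) =
  card-singleton ([] , t) λ { ([] , t′) → cong ([] ,_) (T-irrelevant t′ t) }
count-allVecs zero q (c-no ¬t c-nil) = card-empty λ { ([] , t) → ¬t t }
count-allVecs (suc k) {N} q c = ↔-trans
  (count-concatMap-tabulate (λ x → L.map (x ∷_) (allVecs k N)) (λ x → Σ (Vec (Fin N) k) (T ∘ q ∘ (x ∷_)))
    (λ x c′ → count-allVecs k (q ∘ (x ∷_)) (count-map (x ∷_) (allVecs k N) c′)) (λ x → x) c)
  (mk↔ₛ′ (λ { (x , w , t) → x ∷ w , t }) (λ { (x ∷ w , t) → x , w , t })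
         (λ { (x ∷ w , t) → refl }) (λ { (x , w , t) → refl }))

-- Membership is a Boolean test so that proofs of it are irrelevant and PermsOfSize q k is counted by Fin.
PermsOfSize : (Perm → Bool) → ℕ → Set
PermsOfSize q k = Σ Perm λ π → size π ≡ k × T (q π)

PermsOfSize-≡ : ∀ {q k} {x y : PermsOfSize q k} → proj₁ x ≡ proj₁ y → x ≡ y
PermsOfSize-≡ {x = π , e , t} {.π , e′ , t′} refl = cong₂ (λ e t → π , e , t) (≡-irrelevant e e′) (T-irrelevant t t′)

card-PermsOfSize : ∀ {P : Perm → Set} (q : Perm → Bool) k {m} → (∀ π → P π ⇔ T (q π)) →
  CardOfSize P k m → Card (PermsOfSize q k) m
card-PermsOfSize q k P⇔q count = ↔-trans
  (count-allVecs k _ (count-cong (Equivalence.to (P⇔q _)) (Equivalence.from (P⇔q _)) count))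
  (mk↔ₛ′ (λ (v , t) → (k , v) , refl , t) (λ { ((.k , v) , refl , t) → v , t })
         (λ { ((.k , v) , refl , t) → refl }) (λ _ → refl))

decidable-from-count : ∀ {P : Perm → Set} {a : ℕ → ℕ} → (∀ k → CardOfSize P k (a k)) → ∀ π → Dec (P π)
decidable-from-count count (k , v) = count-dec (count k) (∈-allVecs v)

⇔-True : ∀ {P : Set} (P? : Dec P) → P ⇔ T ⌊ P? ⌋
⇔-True _ = mk⇔ fromWitness toWitness

-- val π i = 0 is a junk value for i ≥ size π.
valᵛ : ∀ {N k} → Vec (Fin N) k → ℕ → ℕ
valᵛ [] i = 0
valᵛ (x ∷ xs) zero = toℕ x
valᵛ (x ∷ xs) (suc i) = valᵛ xs i

val : Perm → ℕ → ℕ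
val (_ , v) = valᵛ v

valᵛ-lookup : ∀ {N k} (v : Vec (Fin N) k) j → valᵛ v (toℕ j) ≡ toℕ (lookup v j)
valᵛ-lookup (x ∷ v) F.zero = refl
valᵛ-lookup (x ∷ v) (F.suc j) = valᵛ-lookup v j

valᵛ-< : ∀ {N k} (v : Vec (Fin N) k) {i} → i < k → valᵛ v i < N
valᵛ-< (x ∷ v) {zero} _ = FP.toℕ<n x
valᵛ-< (x ∷ v) {suc i} (s≤s i<k) = valᵛ-< v i<k

valᵛ-++ˡ : ∀ {N a b} (xs : Vec (Fin N) a) (ys : Vec (Fin N) b) {i} → i < a →
  valᵛ (xs ++ ys) i ≡ valᵛ xs i
valᵛ-++ˡ (x ∷ xs) ys {zero} _ = refl
valᵛ-++ˡ (x ∷ xs) ys {suc i} (s≤s i<a) = valᵛ-++ˡ xs ys i<a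

valᵛ-++ʳ : ∀ {N a b} (xs : Vec (Fin N) a) (ys : Vec (Fin N) b) i →
  valᵛ (xs ++ ys) (a + i) ≡ valᵛ ys i
valᵛ-++ʳ [] ys i = refl
valᵛ-++ʳ (x ∷ xs) ys i = valᵛ-++ʳ xs ys i

valᵛ-map : ∀ {N M k} (g : Fin N → Fin M) (h : ℕ → ℕ) → (∀ x → toℕ (g x) ≡ h (toℕ x)) →
  (xs : Vec (Fin N) k) → ∀ {i} → i < k → valᵛ (map g xs) i ≡ h (valᵛ xs i)
valᵛ-map g h g≗h (x ∷ xs) {zero} _ = g≗h x
valᵛ-map g h g≗h (x ∷ xs) {suc i} (s≤s i<k) = valᵛ-map g h g≗h xs i<k

valᵛ-tabulate : ∀ {N k} (f : Fin k → Fin N) {i} (i<k : i < k) →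
  valᵛ (tabulate f) i ≡ toℕ (f (fromℕ< i<k))
valᵛ-tabulate {k = suc k} f {zero} _ = refl
valᵛ-tabulate {k = suc k} f {suc i} (s≤s i<k) = valᵛ-tabulate (λ j → f (F.suc j)) i<k

valᵛ-injective : ∀ {N k} (v w : Vec (Fin N) k) → (∀ {i} → i < k → valᵛ v i ≡ valᵛ w i) → v ≡ w
valᵛ-injective [] [] _ = refl
valᵛ-injective (x ∷ v) (y ∷ w) v≗w =
  cong₂ _∷_ (FP.toℕ-injective (v≗w z<s)) (valᵛ-injective v w (λ i<k → v≗w (s≤s i<k)))

val-< : ∀ π {i} → i < size π → val π i < size π
val-< (_ , v) = valᵛ-< v

val-injective : ∀ π σ → size π ≡ size σ → (∀ {i} → i < size π → val π i ≡ val σ i) → π ≡ σ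
val-injective (n , v) (.n , w) refl v≗w = cong (n ,_) (valᵛ-injective v w v≗w)

val-⊕ˡ : ∀ σ τ {i} → i < size σ → val (σ ⊕ τ) i ≡ val σ i
val-⊕ˡ (a , σ) (b , τ) i<a = trans (valᵛ-++ˡ (map (_↑ˡ b) σ) (map (a ↑ʳ_) τ) i<a)
  (valᵛ-map (_↑ˡ b) (λ x → x) (λ x → FP.toℕ-↑ˡ x b) σ i<a)

val-⊕ʳ : ∀ σ τ {k} → k < size τ → val (σ ⊕ τ) (size σ + k) ≡ size σ + val τ k
val-⊕ʳ (a , σ) (b , τ) {k} k<b = trans (valᵛ-++ʳ (map (_↑ˡ b) σ) (map (a ↑ʳ_) τ) k)
  (valᵛ-map (a ↑ʳ_) (a +_) (λ x → FP.toℕ-↑ʳ a x) τ k<b)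

val-rc : ∀ π {j k} → suc (j + k) ≡ size π → suc (val (rc π) j + val π k) ≡ size π
val-rc (n , v) {j} {k} 1+j+k≡n = begin
  suc (val (rc (n , v)) j + valᵛ v k)  ≡⟨ cong (λ x → suc (x + valᵛ v k)) rc-value ⟩
  suc (n ∸ suc (valᵛ v k) + valᵛ v k)  ≡⟨ +-suc _ _ ⟨
  n ∸ suc (valᵛ v k) + suc (valᵛ v k)  ≡⟨ m∸n+n≡m (valᵛ-< v k<n) ⟩
  n                                    ∎
  where
  open ≡-Reasoning
  j<n : j < n
  j<n = subst (j <_) 1+j+k≡n (s≤s (m≤m+n j k))
  k<n : k < n
  k<n = subst (k <_) 1+j+k≡n (s≤s (m≤n+m k j))
  opposite-j : toℕ (opposite (fromℕ< j<n)) ≡ k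
  opposite-j = begin
    toℕ (opposite (fromℕ< j<n))  ≡⟨ FP.opposite-prop _ ⟩
    n ∸ suc (toℕ (fromℕ< j<n))   ≡⟨ cong (λ z → n ∸ suc z) (FP.toℕ-fromℕ< j<n) ⟩
    n ∸ suc j                    ≡⟨ cong (_∸ suc j) 1+j+k≡n ⟨
    suc (j + k) ∸ suc j          ≡⟨ m+n∸m≡n (suc j) k ⟩
    k                            ∎
  rc-value : val (rc (n , v)) j ≡ n ∸ suc (valᵛ v k)
  rc-value = begin
    val (rc (n , v)) j                                   ≡⟨ valᵛ-tabulate _ j<n ⟩
    toℕ (opposite (lookup v (opposite (fromℕ< j<n))))   ≡⟨ FP.opposite-prop _ ⟩
    n ∸ suc (toℕ (lookup v (opposite (fromℕ< j<n))))    ≡⟨ cong (λ z → n ∸ suc z) (valᵛ-lookup v _) ⟨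
    n ∸ suc (valᵛ v (toℕ (opposite (fromℕ< j<n))))      ≡⟨ cong (λ z → n ∸ suc (valᵛ v z)) opposite-j ⟩
    n ∸ suc (valᵛ v k)                                   ∎

val-rc-unique : ∀ π {j k x} → suc (j + k) ≡ size π → suc (x + val π k) ≡ size π → val (rc π) j ≡ x
val-rc-unique π {k = k} 1+j+k≡n 1+x+πk≡n =
  +-cancelʳ-≡ (val π k) _ _ (suc-injective (trans (val-rc π 1+j+k≡n) (sym 1+x+πk≡n)))

mirror-position : ∀ {i n} → i < n → ∃ λ k → suc (i + k) ≡ n
mirror-position i<n = m≤n⇒∃[o]m+o≡n i<n

<⊎offset : ∀ a i → i < a ⊎ ∃ λ k → a + k ≡ i
<⊎offset a i with i <? a
... | yes i<a = inj₁ i<a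
... | no i≮a = inj₂ (m≤n⇒∃[o]m+o≡n (≮⇒≥ i≮a))

<-balance : ∀ {a b c d} → a + b ≡ c + d → a < c → d < b
<-balance {a} {b} {c} {d} a+b≡c+d a<c = ≰⇒> λ b≤d → <-irrefl a+b≡c+d (+-mono-<-≤ a<c b≤d)

⊕-assoc : ∀ σ τ υ → (σ ⊕ τ) ⊕ υ ≡ σ ⊕ (τ ⊕ υ)
⊕-assoc σ@(a , _) τ@(b , _) υ@(c , _) = val-injective _ _ (+-assoc a b c) same
  where
  open ≡-Reasoning
  same : ∀ {i} → i < (a + b) + c → val ((σ ⊕ τ) ⊕ υ) i ≡ val (σ ⊕ (τ ⊕ υ)) i
  same {i} i<a+b+c with <⊎offset (a + b) i
  ... | inj₂ (k , refl) = begin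
    val ((σ ⊕ τ) ⊕ υ) ((a + b) + k)    ≡⟨ val-⊕ʳ (σ ⊕ τ) υ k<c ⟩
    (a + b) + val υ k                  ≡⟨ +-assoc a b _ ⟩
    a + (b + val υ k)                  ≡⟨ cong (a +_) (val-⊕ʳ τ υ k<c) ⟨
    a + val (τ ⊕ υ) (b + k)            ≡⟨ val-⊕ʳ σ (τ ⊕ υ) (+-monoʳ-< b k<c) ⟨
    val (σ ⊕ (τ ⊕ υ)) (a + (b + k))    ≡⟨ cong (val (σ ⊕ (τ ⊕ υ))) (+-assoc a b k) ⟨
    val (σ ⊕ (τ ⊕ υ)) ((a + b) + k)    ∎
    where
    k<c : k < c
    k<c = +-cancelˡ-< (a + b) k c i<a+b+c
  ... | inj₁ i<a+b with <⊎offset a i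
  ... | inj₁ i<a = begin
    val ((σ ⊕ τ) ⊕ υ) i  ≡⟨ val-⊕ˡ (σ ⊕ τ) υ i<a+b ⟩
    val (σ ⊕ τ) i        ≡⟨ val-⊕ˡ σ τ i<a ⟩
    val σ i              ≡⟨ val-⊕ˡ σ (τ ⊕ υ) i<a ⟨
    val (σ ⊕ (τ ⊕ υ)) i  ∎
  ... | inj₂ (k , refl) = begin
    val ((σ ⊕ τ) ⊕ υ) (a + k)  ≡⟨ val-⊕ˡ (σ ⊕ τ) υ i<a+b ⟩
    val (σ ⊕ τ) (a + k)        ≡⟨ val-⊕ʳ σ τ k<b ⟩
    a + val τ k                ≡⟨ cong (a +_) (val-⊕ˡ τ υ k<b) ⟨
    a + val (τ ⊕ υ) k          ≡⟨ val-⊕ʳ σ (τ ⊕ υ) (≤-trans k<b (m≤m+n b c)) ⟨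
    val (σ ⊕ (τ ⊕ υ)) (a + k)  ∎
    where
    k<b : k < b
    k<b = +-cancelˡ-< a k b i<a+b

rc-⊕ : ∀ σ τ → rc (σ ⊕ τ) ≡ rc τ ⊕ rc σ
rc-⊕ σ@(a , _) τ@(b , _) = val-injective _ _ (+-comm a b) same
  where
  open ≡-Reasoning
  shiftʳ : ∀ x a y → suc (x + (a + y)) ≡ a + suc (x + y)
  shiftʳ = solve-∀
  shiftˡ : ∀ b x y → suc ((b + x) + y) ≡ suc (x + y) + b
  shiftˡ = solve-∀
  same : ∀ {i} → i < a + b → val (rc (σ ⊕ τ)) i ≡ val (rc τ ⊕ rc σ) i
  same {i} i<a+b with <⊎offset b i
  ... | inj₁ i<b = val-rc-unique (σ ⊕ τ) (trans (shiftʳ i a k) (cong (a +_) 1+i+k≡b)) (begin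
    suc (val (rc τ ⊕ rc σ) i + val (σ ⊕ τ) (a + k))  ≡⟨ cong₂ (λ x y → suc (x + y)) (val-⊕ˡ (rc τ) (rc σ) i<b) (val-⊕ʳ σ τ k<b) ⟩
    suc (val (rc τ) i + (a + val τ k))               ≡⟨ shiftʳ (val (rc τ) i) a (val τ k) ⟩
    a + suc (val (rc τ) i + val τ k)                 ≡⟨ cong (a +_) (val-rc τ 1+i+k≡b) ⟩
    a + b                                            ∎)
    where
    k : ℕ
    k = proj₁ (mirror-position i<b)
    1+i+k≡b : suc (i + k) ≡ b
    1+i+k≡b = proj₂ (mirror-position i<b)
    k<b : k < b
    k<b = subst (k <_) 1+i+k≡b (s≤s (m≤n+m k i))
  ... | inj₂ (j , refl) = val-rc-unique (σ ⊕ τ) (trans (shiftˡ b j k) (cong (_+ b) 1+j+k≡a)) (begin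
    suc (val (rc τ ⊕ rc σ) (b + j) + val (σ ⊕ τ) k)  ≡⟨ cong₂ (λ x y → suc (x + y)) (val-⊕ʳ (rc τ) (rc σ) j<a) (val-⊕ˡ σ τ k<a) ⟩
    suc ((b + val (rc σ) j) + val σ k)               ≡⟨ shiftˡ b (val (rc σ) j) (val σ k) ⟩
    suc (val (rc σ) j + val σ k) + b                 ≡⟨ cong (_+ b) (val-rc σ 1+j+k≡a) ⟩
    a + b                                            ∎)
    where
    j<a : j < a
    j<a = +-cancelˡ-< b j a (subst (b + j <_) (+-comm a b) i<a+b)
    k : ℕ
    k = proj₁ (mirror-position j<a)
    1+j+k≡a : suc (j + k) ≡ a
    1+j+k≡a = proj₂ (mirror-position j<a)
    k<a : k < a
    k<a = subst (k <_) 1+j+k≡a (s≤s (m≤n+m k j))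

rc-involutive : ∀ π → rc (rc π) ≡ π
rc-involutive π@(n , _) = val-injective _ _ refl λ {i} i<n →
  let k , 1+i+k≡n = mirror-position i<n
  in val-rc-unique (rc π) 1+i+k≡n (trans (cong suc (+-comm (val π i) _))
       (val-rc π (trans (cong suc (+-comm k i)) 1+i+k≡n)))

⊕-injective : ∀ σ τ σ′ τ′ → σ ⊕ τ ≡ σ′ ⊕ τ′ → size σ ≡ size σ′ → σ ≡ σ′ × τ ≡ τ′
⊕-injective σ@(a , _) τ@(b , _) σ′ τ′@(b′ , _) σ⊕τ≡σ′⊕τ′ refl =
  val-injective σ σ′ refl same-σ , val-injective τ τ′ b≡b′ same-τ
  where
  open ≡-Reasoning
  b≡b′ : b ≡ b′
  b≡b′ = +-cancelˡ-≡ a b b′ (cong size σ⊕τ≡σ′⊕τ′)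
  same-σ : ∀ {i} → i < a → val σ i ≡ val σ′ i
  same-σ {i} i<a = begin
    val σ i           ≡⟨ val-⊕ˡ σ τ i<a ⟨
    val (σ ⊕ τ) i     ≡⟨ cong (λ π → val π i) σ⊕τ≡σ′⊕τ′ ⟩
    val (σ′ ⊕ τ′) i   ≡⟨ val-⊕ˡ σ′ τ′ i<a ⟩
    val σ′ i          ∎
  same-τ : ∀ {k} → k < b → val τ k ≡ val τ′ k
  same-τ {k} k<b = +-cancelˡ-≡ a _ _ (begin
    a + val τ k          ≡⟨ val-⊕ʳ σ τ k<b ⟨
    val (σ ⊕ τ) (a + k)  ≡⟨ cong (λ π → val π (a + k)) σ⊕τ≡σ′⊕τ′ ⟩
    val (σ′ ⊕ τ′) (a + k) ≡⟨ val-⊕ʳ σ′ τ′ (subst (k <_) b≡b′ k<b) ⟩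
    a + val τ′ k         ∎)

centrosymmetric? : ∀ π → Dec (Centrosymmetric π)
centrosymmetric? π = PP.≡-dec _≟_ (VP.≡-dec FP._≟_) (rc π) π

val-centrosymmetric : ∀ π → Centrosymmetric π → ∀ {j k} → suc (j + k) ≡ size π → suc (val π j + val π k) ≡ size π
val-centrosymmetric π rcπ≡π {j} {k} 1+j+k≡n = subst (λ ρ → suc (val ρ j + val π k) ≡ size π) rcπ≡π (val-rc π 1+j+k≡n)

record Occurrence (σ π : Perm) : Set where
  field
    pos : ℕ → ℕ
    shift : ℕ
    pos-increasing : ∀ {i j} → i < j → pos i < pos j
    pos-in-range : ∀ {i} → i < size σ → pos i < size π
    val-shifted : ∀ {i} → i < size σ → val π (pos i) ≡ shift + val σ i

module _ {σ π : Perm} (occ : Occurrence σ π) where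
  open Occurrence occ

  private
    σᵛ : Vec (Fin (size σ)) (size σ)
    σᵛ = proj₂ σ
    πᵛ : Vec (Fin (size π)) (size π)
    πᵛ = proj₂ π

    f : Fin (size σ) → Fin (size π)
    f i = fromℕ< (pos-in-range (FP.toℕ<n i))

    toℕ-f : ∀ i → toℕ (f i) ≡ pos (toℕ i)
    toℕ-f i = FP.toℕ-fromℕ< _

    value-f : ∀ i → toℕ (lookup πᵛ (f i)) ≡ shift + toℕ (lookup σᵛ i)
    value-f i = begin
      toℕ (lookup πᵛ (f i))          ≡⟨ valᵛ-lookup πᵛ (f i) ⟨
      val π (toℕ (f i))              ≡⟨ cong (val π) (toℕ-f i) ⟩
      val π (pos (toℕ i))            ≡⟨ val-shifted (FP.toℕ<n i) ⟩
      shift + val σ (toℕ i)          ≡⟨ cong (shift +_) (valᵛ-lookup σᵛ i) ⟩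
      shift + toℕ (lookup σᵛ i)      ∎
      where open ≡-Reasoning

  occurrence⇒≼ : σ ≼ π
  occurrence⇒≼ = f , increasing , order-preserved
    where
    increasing : ∀ i j → i F.< j → f i F.< f j
    increasing i j i<j = subst₂ _<_ (sym (toℕ-f i)) (sym (toℕ-f j)) (pos-increasing i<j)
    order-preserved : ∀ i j → (lookup σᵛ i F.< lookup σᵛ j) ⇔ (lookup πᵛ (f i) F.< lookup πᵛ (f j))
    order-preserved i j = mk⇔
      (λ lt → subst₂ _<_ (sym (value-f i)) (sym (value-f j)) (+-monoʳ-< shift lt))
      (λ lt → +-cancelˡ-< shift _ _ (subst₂ _<_ (value-f i) (value-f j) lt))

  occurrence⇒isPerm : IsPerm π → IsPerm σ
  occurrence⇒isPerm π-perm i j σi≡σj = FP.toℕ-injective (pos-injective f-agrees)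
    where
    f-agrees : toℕ (f i) ≡ toℕ (f j)
    f-agrees = cong toℕ (π-perm (f i) (f j) (FP.toℕ-injective
      (trans (value-f i) (trans (cong (λ x → shift + toℕ x) σi≡σj) (sym (value-f j))))))
    pos-injective : toℕ (f i) ≡ toℕ (f j) → toℕ i ≡ toℕ j
    pos-injective e with <-cmp (toℕ i) (toℕ j)
    ... | tri< lt _ _ = ⊥-elim (<-irrefl (trans (sym (toℕ-f i)) (trans e (toℕ-f j))) (pos-increasing lt))
    ... | tri≈ _ eq _ = eq
    ... | tri> _ _ gt = ⊥-elim (<-irrefl (trans (sym (toℕ-f j)) (trans (sym e) (toℕ-f i))) (pos-increasing gt))

empty-occurrence : ∀ π → Occurrence (0 , []) π
empty-occurrence π = record
  { pos = λ i → i ; shift = 0 ; pos-increasing = λ i<j → i<j ; pos-in-range = λ () ; val-shifted = λ () }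

-- π splits at t when π = σ ⊕ τ with size σ = t, phrased on values so that it is decidable.
SplitsAt : Perm → ℕ → Set
SplitsAt π t = (∀ {i} → i < t → val π i < t) × (∀ {i} → i < size π → t ≤ i → t ≤ val π i)

splitsAt? : ∀ π t → Dec (SplitsAt π t)
splitsAt? π t = allUpTo? (λ i → val π i <? t) t ×-dec allUpTo? (λ i → t ≤? i →-dec t ≤? val π i) (size π)

splitsAt-0 : ∀ π → SplitsAt π 0
splitsAt-0 π = (λ ()) , (λ _ _ → z≤n)

splitsAt-size : ∀ π → SplitsAt π (size π)
splitsAt-size π = val-< π , λ i<n n≤i → ⊥-elim (<⇒≱ i<n n≤i)

splitsAt-⊕ˡ⁺ : ∀ σ τ {t} → t ≤ size σ → SplitsAt σ t → SplitsAt (σ ⊕ τ) t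
splitsAt-⊕ˡ⁺ σ@(a , _) τ@(b , _) {t} t≤a (low , high) = low′ , high′
  where
  low′ : ∀ {i} → i < t → val (σ ⊕ τ) i < t
  low′ i<t = subst (_< t) (sym (val-⊕ˡ σ τ (<-≤-trans i<t t≤a))) (low i<t)
  high′ : ∀ {i} → i < a + b → t ≤ i → t ≤ val (σ ⊕ τ) i
  high′ {i} i<a+b t≤i with <⊎offset a i
  ... | inj₁ i<a = subst (t ≤_) (sym (val-⊕ˡ σ τ i<a)) (high i<a t≤i)
  ... | inj₂ (k , refl) = subst (t ≤_) (sym (val-⊕ʳ σ τ (+-cancelˡ-< a k b i<a+b))) (≤-trans t≤a (m≤m+n a _))

splitsAt-⊕ˡ⁻ : ∀ σ τ {t} → t ≤ size σ → SplitsAt (σ ⊕ τ) t → SplitsAt σ t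
splitsAt-⊕ˡ⁻ σ@(a , _) τ@(b , _) {t} t≤a (low , high) = low′ , high′
  where
  low′ : ∀ {i} → i < t → val σ i < t
  low′ i<t = subst (_< t) (val-⊕ˡ σ τ (<-≤-trans i<t t≤a)) (low i<t)
  high′ : ∀ {i} → i < a → t ≤ i → t ≤ val σ i
  high′ i<a t≤i = subst (t ≤_) (val-⊕ˡ σ τ i<a) (high (≤-trans i<a (m≤m+n a b)) t≤i)

splitsAt-⊕ : ∀ σ τ → SplitsAt (σ ⊕ τ) (size σ)
splitsAt-⊕ σ τ = splitsAt-⊕ˡ⁺ σ τ ≤-refl (splitsAt-size σ)

splitsAt-⊕ʳ⁺ : ∀ σ τ {u} → u ≤ size τ → SplitsAt τ u → SplitsAt (σ ⊕ τ) (size σ + u)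
splitsAt-⊕ʳ⁺ σ@(a , _) τ@(b , _) {u} u≤b (low , high) = low′ , high′
  where
  low′ : ∀ {i} → i < a + u → val (σ ⊕ τ) i < a + u
  low′ {i} i<a+u with <⊎offset a i
  ... | inj₁ i<a = subst (_< a + u) (sym (val-⊕ˡ σ τ i<a)) (<-≤-trans (val-< σ i<a) (m≤m+n a u))
  ... | inj₂ (k , refl) = subst (_< a + u) (sym (val-⊕ʳ σ τ (<-≤-trans k<u u≤b))) (+-monoʳ-< a (low k<u))
    where
    k<u : k < u
    k<u = +-cancelˡ-< a k u i<a+u
  high′ : ∀ {i} → i < a + b → a + u ≤ i → a + u ≤ val (σ ⊕ τ) i
  high′ {i} i<a+b a+u≤i with <⊎offset a i
  ... | inj₁ i<a = ⊥-elim (<⇒≱ i<a (≤-trans (m≤m+n a u) a+u≤i))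
  ... | inj₂ (k , refl) = subst (a + u ≤_) (sym (val-⊕ʳ σ τ k<b)) (+-monoʳ-≤ a (high k<b (+-cancelˡ-≤ a u k a+u≤i)))
    where
    k<b : k < b
    k<b = +-cancelˡ-< a k b i<a+b

splitsAt-⊕ʳ⁻ : ∀ σ τ {u} → u ≤ size τ → SplitsAt (σ ⊕ τ) (size σ + u) → SplitsAt τ u
splitsAt-⊕ʳ⁻ σ@(a , _) τ@(b , _) {u} u≤b (low , high) = low′ , high′
  where
  low′ : ∀ {k} → k < u → val τ k < u
  low′ k<u = +-cancelˡ-< a _ u (subst (_< a + u) (val-⊕ʳ σ τ (<-≤-trans k<u u≤b)) (low (+-monoʳ-< a k<u)))
  high′ : ∀ {k} → k < b → u ≤ k → u ≤ val τ k
  high′ k<b u≤k = +-cancelˡ-≤ a u _ (subst (a + u ≤_) (val-⊕ʳ σ τ k<b) (high (+-monoʳ-< a k<b) (+-monoʳ-≤ a u≤k)))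

-- In a centrosymmetric π, positions i and k with i + k + 1 = size π carry values summing to size π − 1.
splitsAt-mirror : ∀ π → Centrosymmetric π → ∀ {s s′} → s + s′ ≡ size π → SplitsAt π s → SplitsAt π s′
splitsAt-mirror π rcπ≡π {s} {s′} s+s′≡n (low , high) = low′ , high′
  where
  complement-< : ∀ {x y} → suc (x + y) ≡ s + s′ → s ≤ y → x < s′
  complement-< {x} {y} e s≤y = +-cancelʳ-≤ y (suc x) s′ (begin
    suc x + y  ≡⟨ trans e (+-comm s s′) ⟩
    s′ + s     ≤⟨ +-monoʳ-≤ s′ s≤y ⟩
    s′ + y     ∎)
    where open ≤-Reasoning
  complement-≥ : ∀ {x y} → suc (x + y) ≡ s + s′ → y < s → s′ ≤ x
  complement-≥ {x} {y} e y<s = +-cancelʳ-≤ (suc y) s′ x (begin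
    s′ + suc y  ≤⟨ +-monoʳ-≤ s′ y<s ⟩
    s′ + s      ≡⟨ trans (+-comm s′ s) (sym e) ⟩
    suc (x + y) ≡⟨ +-suc x y ⟨
    x + suc y   ∎)
    where open ≤-Reasoning
  mirror : ∀ {i} → i < size π → ∃ λ k → k < size π × suc (i + k) ≡ s + s′ × suc (val π i + val π k) ≡ s + s′
  mirror {i} i<n = let k , 1+i+k≡n = mirror-position i<n in
    k , subst (k <_) 1+i+k≡n (s≤s (m≤n+m k i)) , trans 1+i+k≡n (sym s+s′≡n) ,
    trans (val-centrosymmetric π rcπ≡π 1+i+k≡n) (sym s+s′≡n)
  low′ : ∀ {i} → i < s′ → val π i < s′
  low′ i<s′ =
    let k , k<n , ik , vik = mirror (<-≤-trans i<s′ (subst (s′ ≤_) s+s′≡n (m≤n+m s′ s)))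
        s≤k = ≮⇒≥ λ k<s → <⇒≱ i<s′ (complement-≥ ik k<s)
    in complement-< vik (high k<n s≤k)
  high′ : ∀ {i} → i < size π → s′ ≤ i → s′ ≤ val π i
  high′ i<n s′≤i =
    let k , k<n , ik , vik = mirror i<n
        k<s = ≰⇒> λ s≤k → <⇒≱ (complement-< ik s≤k) s′≤i
    in complement-≥ vik (low k<s)

-- An out-of-range value g i is replaced by the junk value i.
clamp : ∀ {n} → ℕ → Fin n → Fin n
clamp {n} x j with x <? n
... | yes x<n = fromℕ< x<n
... | no _ = j

fromVals : (n : ℕ) → (ℕ → ℕ) → Perm
fromVals n g = n , tabulate λ j → clamp (g (toℕ j)) j

val-fromVals : ∀ n g {i} → i < n → g i < n → val (fromVals n g) i ≡ g i
val-fromVals n g {i} i<n gi<n = trans (valᵛ-tabulate _ i<n) (clamped (fromℕ< i<n) (sym (FP.toℕ-fromℕ< i<n)))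
  where
  clamped : ∀ (j : Fin n) → i ≡ toℕ j → toℕ (clamp (g (toℕ j)) j) ≡ g i
  clamped j refl with g (toℕ j) <? n
  ... | yes x<n = FP.toℕ-fromℕ< x<n
  ... | no x≮n = ⊥-elim (x≮n gi<n)

prefix : Perm → ℕ → Perm
prefix π t = fromVals t (val π)

suffix : Perm → ℕ → Perm
suffix π t = fromVals (size π ∸ t) λ k → val π (t + k) ∸ t

module _ {π t} (split : SplitsAt π t) (t≤n : t ≤ size π) where

  val-prefix : ∀ {i} → i < t → val (prefix π t) i ≡ val π i
  val-prefix i<t = val-fromVals t (val π) i<t (proj₁ split i<t)

  suffix-in-range : ∀ {k} → k < size π ∸ t → t + k < size π
  suffix-in-range k<n-t = subst (_ <_) (m+[n∸m]≡n t≤n) (+-monoʳ-< t k<n-t)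

  val-suffix : ∀ {k} → k < size π ∸ t → t + val (suffix π t) k ≡ val π (t + k)
  val-suffix {k} k<n-t = begin
    t + val (suffix π t) k      ≡⟨ cong (t +_) (val-fromVals _ _ k<n-t (∸-monoˡ-< (val-< π (suffix-in-range k<n-t)) t≤πt+k)) ⟩
    t + (val π (t + k) ∸ t)     ≡⟨ m+[n∸m]≡n t≤πt+k ⟩
    val π (t + k)               ∎
    where
    open ≡-Reasoning
    t≤πt+k : t ≤ val π (t + k)
    t≤πt+k = proj₂ split (suffix-in-range k<n-t) (m≤m+n t k)

  split-decomposition : π ≡ prefix π t ⊕ suffix π t
  split-decomposition = val-injective π _ (sym (m+[n∸m]≡n t≤n)) same
    where
    same : ∀ {i} → i < size π → val π i ≡ val (prefix π t ⊕ suffix π t) i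
    same {i} i<n with <⊎offset t i
    ... | inj₁ i<t = sym (trans (val-⊕ˡ (prefix π t) (suffix π t) i<t) (val-prefix i<t))
    ... | inj₂ (k , refl) = sym (trans (val-⊕ʳ (prefix π t) (suffix π t) k<n-t) (val-suffix k<n-t))
      where
      k<n-t : k < size π ∸ t
      k<n-t = +-cancelˡ-< t k (size π ∸ t) (subst (t + k <_) (sym (m+[n∸m]≡n t≤n)) i<n)

  prefix-occurrence : Occurrence (prefix π t) π
  prefix-occurrence = record
    { pos = λ i → i ; shift = 0 ; pos-increasing = λ i<j → i<j
    ; pos-in-range = λ i<t → <-≤-trans i<t t≤n ; val-shifted = λ i<t → sym (val-prefix i<t) }

  suffix-occurrence : Occurrence (suffix π t) π
  suffix-occurrence = record
    { pos = t +_ ; shift = t ; pos-increasing = +-monoʳ-< t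
    ; pos-in-range = suffix-in-range ; val-shifted = λ k<n-t → sym (val-suffix k<n-t) }

NoSplit : Perm → Set
NoSplit π = ∀ {t} → t < size π → 0 < t → ¬ SplitsAt π t

noSplit? : ∀ π → Dec (NoSplit π)
noSplit? π = allUpTo? (λ t → 0 <? t →-dec ¬? (splitsAt? π t)) (size π)

noSplit⇒sumIndecomposable : ∀ π → NoSplit π → SumIndecomposable π
noSplit⇒sumIndecomposable _ noSplit (σ@(a , _) , τ , 0<a , 0<b , refl) =
  noSplit (m<m+n a 0<b) 0<a (splitsAt-⊕ σ τ)

sumIndecomposable⇒noSplit : ∀ π → SumIndecomposable π → NoSplit π
sumIndecomposable⇒noSplit π indecomposable {t} t<n 0<t split =
  indecomposable (prefix π t , suffix π t , 0<t , m<n⇒0<n∸m t<n , split-decomposition split (<⇒≤ t<n))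

LastSplitUpTo : Perm → ℕ → ℕ → Set
LastSplitUpTo π n s = SplitsAt π s × s ≤ n × (∀ {t} → s < t → t ≤ n → ¬ SplitsAt π t)

lastSplitUpTo : ∀ π n → ∃ (LastSplitUpTo π n)
lastSplitUpTo π zero = 0 , splitsAt-0 π , z≤n , λ s<t t≤0 _ → <⇒≱ s<t t≤0
lastSplitUpTo π (suc n) with splitsAt? π (suc n)
... | yes split = suc n , split , ≤-refl , λ s<t t≤n _ → <⇒≱ s<t t≤n
... | no ¬split =
  let s , split , s≤n , last = lastSplitUpTo π n
  in s , split , m≤n⇒m≤1+n s≤n , λ s<t t≤1+n → [ (λ t<1+n → last s<t (s≤s⁻¹ t<1+n)) , (λ { refl → ¬split }) ]′ (m≤n⇒m<n∨m≡n t≤1+n)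

lastSplitUpTo-unique : ∀ {π n s s′} → LastSplitUpTo π n s → LastSplitUpTo π n s′ → s ≡ s′
lastSplitUpTo-unique {s = s} {s′} (split , s≤n , last) (split′ , s′≤n , last′) with <-cmp s s′
... | tri< s<s′ _ _ = ⊥-elim (last s<s′ s′≤n split′)
... | tri≈ _ s≡s′ _ = s≡s′
... | tri> _ _ s′<s = ⊥-elim (last′ s′<s s≤n split)

prefix-suffix-⊕ : ∀ σ τ → prefix (σ ⊕ τ) (size σ) ≡ σ × suffix (σ ⊕ τ) (size σ) ≡ τ
prefix-suffix-⊕ σ@(a , _) τ@(b , _) = ⊕-injective _ _ σ τ
  (sym (split-decomposition (splitsAt-⊕ σ τ) (m≤m+n a b))) refl

sandwich : Perm → Perm → Perm
sandwich α γ = α ⊕ (γ ⊕ rc α)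

sandwich-centrosymmetric : ∀ α γ → Centrosymmetric γ → Centrosymmetric (sandwich α γ)
sandwich-centrosymmetric α γ rcγ≡γ = begin
  rc (α ⊕ (γ ⊕ rc α))         ≡⟨ rc-⊕ α (γ ⊕ rc α) ⟩
  rc (γ ⊕ rc α) ⊕ rc α        ≡⟨ cong (_⊕ rc α) (rc-⊕ γ (rc α)) ⟩
  (rc (rc α) ⊕ rc γ) ⊕ rc α   ≡⟨ cong₂ (λ σ τ → (σ ⊕ τ) ⊕ rc α) (rc-involutive α) rcγ≡γ ⟩
  (α ⊕ γ) ⊕ rc α              ≡⟨ ⊕-assoc α γ (rc α) ⟩
  α ⊕ (γ ⊕ rc α)              ∎
  where open ≡-Reasoning

centrosymmetric-sandwich : ∀ α γ β → Centrosymmetric (α ⊕ (γ ⊕ β)) → size β ≡ size α →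
  β ≡ rc α × Centrosymmetric γ
centrosymmetric-sandwich α@(a , _) γ@(g , _) β@(.a , _) centro refl =
  let α⊕γ≡rcβ⊕rcγ , β≡rcα = ⊕-injective (α ⊕ γ) β (rc β ⊕ rc γ) (rc α) mirrored refl
      _ , γ≡rcγ = ⊕-injective α γ (rc β) (rc γ) α⊕γ≡rcβ⊕rcγ refl
  in β≡rcα , sym γ≡rcγ
  where
  open ≡-Reasoning
  mirrored : (α ⊕ γ) ⊕ β ≡ (rc β ⊕ rc γ) ⊕ rc α
  mirrored = begin
    (α ⊕ γ) ⊕ β            ≡⟨ ⊕-assoc α γ β ⟩
    α ⊕ (γ ⊕ β)            ≡⟨ centro ⟨
    rc (α ⊕ (γ ⊕ β))       ≡⟨ rc-⊕ α (γ ⊕ β) ⟩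
    rc (γ ⊕ β) ⊕ rc α      ≡⟨ cong (_⊕ rc α) (rc-⊕ γ β) ⟩
    (rc β ⊕ rc γ) ⊕ rc α   ∎

module Decomposition (C : Perm → Set) (class : IsPermClass C) (sumClosed : SumClosed C)
                     (rcInvariant : RcInvariant C) (C? : ∀ π → Dec (C π)) where

  open IsPermClass class

  occurrence-in-class : ∀ {σ π} → Occurrence σ π → C π → C σ
  occurrence-in-class {σ} {π} occ Cπ =
    downClosed σ π (occurrence⇒isPerm occ (onlyPerms π Cπ)) (occurrence⇒≼ occ) Cπ

  inC inB inD : Perm → Bool
  inC π = ⌊ C? π ⌋
  inB π = ⌊ C? π ×-dec centrosymmetric? π ⌋
  inD π = ⌊ C? π ×-dec centrosymmetric? π ×-dec noSplit? π ⌋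

  -- The middle block of size 2i: the empty permutation when i = 0, one counted by d i otherwise.
  inG : ℕ → Perm → Bool
  inG zero _ = true
  inG (suc _) = inD

  Middle : Perm → Set
  Middle γ = C γ × Centrosymmetric γ × NoSplit γ

  middle-properties : ∀ {i γ α} → size γ ≡ 2 * i → T (inG i γ) → C α → Middle γ
  middle-properties {zero} {.0 , []} refl _ Cα = occurrence-in-class (empty-occurrence _) Cα , refl , λ ()
  middle-properties {suc i} _ γ∈D _ = toWitness γ∈D

  middle-intro : ∀ {i γ} → Middle γ → T (inG i γ)
  middle-intro {zero} _ = tt
  middle-intro {suc i} middle = fromWitness middle

  Decomposed : ℕ → Set
  Decomposed n = Σ ℕ λ i → i ≤ n × (PermsOfSize (inG i) (2 * i) × PermsOfSize inC (n ∸ i))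

  Decomposed-≡ : ∀ {n i i′ i≤n i′≤n γ γ′ α α′} → i ≡ i′ → proj₁ γ ≡ proj₁ γ′ → proj₁ α ≡ proj₁ α′ →
    _≡_ {A = Decomposed n} (i , i≤n , γ , α) (i′ , i′≤n , γ′ , α′)
  Decomposed-≡ refl γ≡γ′ α≡α′ =
    cong₂ (λ p γα → _ , p , γα) (≤-irrelevant _ _) (cong₂ _,_ (PermsOfSize-≡ γ≡γ′) (PermsOfSize-≡ α≡α′))

  -- π = α ⊕ (γ ⊕ rc α), where s = size α is the last split point of π up to the middle n.
  module Split {n π} (|π|≡2n : size π ≡ 2 * n) (Cπ : C π) (centro : Centrosymmetric π)
               {s} (last : LastSplitUpTo π n s) where

    i L : ℕ
    i = n ∸ s
    L = 2 * i

    α ρ γ β : Perm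
    α = prefix π s
    ρ = suffix π s
    γ = prefix ρ L
    β = suffix ρ L

    private
      split : SplitsAt π s
      split = proj₁ last
      s≤n : s ≤ n
      s≤n = proj₁ (proj₂ last)

      |π|≡s+[L+s] : size π ≡ s + (L + s)
      |π|≡s+[L+s] = trans |π|≡2n (trans (cong (2 *_) (sym (m+[n∸m]≡n s≤n))) (double s i))
        where
        double : ∀ s i → 2 * (s + i) ≡ s + (2 * i + s)
        double = solve-∀

      s≤|π| : s ≤ size π
      s≤|π| = subst (s ≤_) (sym |π|≡s+[L+s]) (m≤m+n s _)

      |ρ| : size ρ ≡ L + s
      |ρ| = trans (cong (_∸ s) |π|≡s+[L+s]) (m+n∸m≡n s (L + s))

      L≤|ρ| : L ≤ size ρ
      L≤|ρ| = subst (L ≤_) (sym |ρ|) (m≤m+n L s)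

      π≡α⊕ρ : π ≡ α ⊕ ρ
      π≡α⊕ρ = split-decomposition split s≤|π|

      ρ-splits : SplitsAt ρ L
      ρ-splits = splitsAt-⊕ʳ⁻ α ρ L≤|ρ| (subst (λ σ → SplitsAt σ (s + L)) π≡α⊕ρ
        (splitsAt-mirror π centro (trans (cong (s +_) (sym (+-comm L s))) (sym |π|≡s+[L+s])) split))

      ρ≡γ⊕β : ρ ≡ γ ⊕ β
      ρ≡γ⊕β = split-decomposition ρ-splits L≤|ρ|

      π≡α⊕[γ⊕β] : π ≡ α ⊕ (γ ⊕ β)
      π≡α⊕[γ⊕β] = trans π≡α⊕ρ (cong (α ⊕_) ρ≡γ⊕β)

      β≡rcα×γ-centro : β ≡ rc α × Centrosymmetric γ
      β≡rcα×γ-centro = centrosymmetric-sandwich α γ β (subst Centrosymmetric π≡α⊕[γ⊕β] centro)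
        (trans (cong (_∸ L) |ρ|) (m+n∸m≡n L s))

    π≡sandwich : π ≡ sandwich α γ
    π≡sandwich = trans π≡α⊕[γ⊕β] (cong (λ β → α ⊕ (γ ⊕ β)) (proj₁ β≡rcα×γ-centro))

    Cα : C α
    Cα = occurrence-in-class (prefix-occurrence split s≤|π|) Cπ

    Cγ : C γ
    Cγ = occurrence-in-class (prefix-occurrence ρ-splits L≤|ρ|)
           (occurrence-in-class (suffix-occurrence split s≤|π|) Cπ)

    -- A split strictly between s and its mirror image s + L is excluded: up to n by the maximality of s,
    -- beyond n because its mirror image would lie in (s, n).
    private
      no-split-between : ∀ {t} → s < t → t < s + L → ¬ SplitsAt π t
      no-split-between {t} s<t t<s+L π-splits with t ≤? n
      ... | yes t≤n = proj₂ (proj₂ last) s<t t≤n π-splits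
      ... | no t≰n = proj₂ (proj₂ last) s<t′ (<⇒≤ t′<n) (splitsAt-mirror π centro t+t′≡|π| π-splits)
        where
        t≤|π| : t ≤ size π
        t≤|π| = subst (t ≤_) (trans (+-assoc s L s) (sym |π|≡s+[L+s])) (≤-trans (<⇒≤ t<s+L) (m≤m+n (s + L) s))
        t′ : ℕ
        t′ = proj₁ (m≤n⇒∃[o]m+o≡n t≤|π|)
        t+t′≡|π| : t + t′ ≡ size π
        t+t′≡|π| = proj₂ (m≤n⇒∃[o]m+o≡n t≤|π|)
        s<t′ : s < t′
        s<t′ = <-balance (trans t+t′≡|π| (trans |π|≡s+[L+s] (sym (+-assoc s L s)))) t<s+L
        t′<n : t′ < n
        t′<n = <-balance (sym (trans t+t′≡|π| (trans |π|≡2n (cong (n +_) (+-identityʳ n))))) (≰⇒> t≰n)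

    γ-noSplit : NoSplit γ
    γ-noSplit {t} t<L 0<t γ-splits = no-split-between (m<m+n s 0<t) (+-monoʳ-< s t<L) π-splits
      where
      ρ-splits-t : SplitsAt ρ t
      ρ-splits-t = subst (λ σ → SplitsAt σ t) (sym ρ≡γ⊕β) (splitsAt-⊕ˡ⁺ γ β (<⇒≤ t<L) γ-splits)
      π-splits : SplitsAt π (s + t)
      π-splits = subst (λ σ → SplitsAt σ (s + t)) (sym π≡α⊕ρ)
        (splitsAt-⊕ʳ⁺ α ρ (≤-trans (<⇒≤ t<L) L≤|ρ|) ρ-splits-t)

    decomposed : Decomposed n
    decomposed = i , m∸n≤m n s , (γ , refl , middle-intro {i} (Cγ , proj₂ β≡rcα×γ-centro , γ-noSplit))
                               , (α , sym (m∸[m∸n]≡n s≤n) , fromWitness Cα)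

  module Glue {n i} (i≤n : i ≤ n) {γ} (|γ| : size γ ≡ 2 * i) (γ∈G : T (inG i γ))
              {α} (|α| : size α ≡ n ∸ i) (α∈C : T (inC α)) where

    π : Perm
    π = sandwich α γ

    private
      Cα : C α
      Cα = toWitness α∈C
      middle : Middle γ
      middle = middle-properties {i} |γ| γ∈G Cα
      |α|+i≡n : size α + i ≡ n
      |α|+i≡n = trans (cong (_+ i) |α|) (m∸n+n≡m i≤n)

    |π|≡2n : size π ≡ 2 * n
    |π|≡2n = trans (cong₂ (λ x y → x + (y + x)) |α| |γ|)
      (trans (sandwich-size (n ∸ i) i) (cong (2 *_) (trans (+-comm (n ∸ i) i) (m+[n∸m]≡n i≤n))))
      where
      sandwich-size : ∀ a i → a + (2 * i + a) ≡ 2 * (a + i)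
      sandwich-size = solve-∀

    Cπ : C π
    Cπ = sumClosed α (γ ⊕ rc α) Cα (sumClosed γ (rc α) (proj₁ middle) (proj₁ rcInvariant α Cα))

    π-centro : Centrosymmetric π
    π-centro = sandwich-centrosymmetric α γ (proj₁ (proj₂ middle))

    last : LastSplitUpTo π n (size α)
    last = splitsAt-⊕ α (γ ⊕ rc α) , subst (size α ≤_) |α|+i≡n (m≤m+n (size α) i) , beyond
      where
      beyond : ∀ {t} → size α < t → t ≤ n → ¬ SplitsAt π t
      beyond {t} |α|<t t≤n π-splits with m≤n⇒∃[o]m+o≡n (<⇒≤ |α|<t)
      ... | u , refl = proj₂ (proj₂ middle) u<|γ| 0<u
            (splitsAt-⊕ˡ⁻ γ (rc α) (<⇒≤ u<|γ|) (splitsAt-⊕ʳ⁻ α (γ ⊕ rc α) (≤-trans (<⇒≤ u<|γ|) (m≤m+n _ _)) π-splits))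
        where
        0<u : 0 < u
        0<u = +-cancelˡ-< (size α) 0 u (subst (_< size α + u) (sym (+-identityʳ (size α))) |α|<t)
        u≤i : u ≤ i
        u≤i = +-cancelˡ-≤ (size α) u i (subst (size α + u ≤_) (sym |α|+i≡n) t≤n)
        u<|γ| : u < size γ
        u<|γ| = subst (u <_) (sym |γ|) (<-≤-trans (m<m+n u 0<u) (+-mono-≤ u≤i (subst (u ≤_) (sym (+-identityʳ i)) u≤i)))

    split-components : ∀ {s} → LastSplitUpTo π n s →
      n ∸ s ≡ i × prefix (suffix π s) (2 * (n ∸ s)) ≡ γ × prefix π s ≡ α
    split-components {s} last′ = i-eq , γ-eq , α-eq
      where
      open ≡-Reasoning
      s≡|α| : s ≡ size α
      s≡|α| = lastSplitUpTo-unique {π} last′ last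
      i-eq : n ∸ s ≡ i
      i-eq = trans (cong (n ∸_) (trans s≡|α| |α|)) (m∸[m∸n]≡n i≤n)
      γ-eq : prefix (suffix π s) (2 * (n ∸ s)) ≡ γ
      γ-eq = begin
        prefix (suffix π s) (2 * (n ∸ s))
          ≡⟨ cong₂ prefix (trans (cong (suffix π) s≡|α|) (proj₂ (prefix-suffix-⊕ α (γ ⊕ rc α))))
                          (trans (cong (2 *_) i-eq) (sym |γ|)) ⟩
        prefix (γ ⊕ rc α) (size γ)
          ≡⟨ proj₁ (prefix-suffix-⊕ γ (rc α)) ⟩
        γ ∎
      α-eq : prefix π s ≡ α
      α-eq = trans (cong (prefix π) s≡|α|) (proj₁ (prefix-suffix-⊕ α (γ ⊕ rc α)))

  centrosymmetric-decomposition : ∀ n → PermsOfSize inB (2 * n) ↔ Decomposed n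
  centrosymmetric-decomposition n = mk↔ₛ′ split glue split∘glue glue∘split
    where
    split : PermsOfSize inB (2 * n) → Decomposed n
    split (π , |π| , π∈B) =
      Split.decomposed |π| (proj₁ (toWitness π∈B)) (proj₂ (toWitness π∈B)) (proj₂ (lastSplitUpTo π n))
    glue : Decomposed n → PermsOfSize inB (2 * n)
    glue (i , i≤n , (γ , |γ| , γ∈G) , (α , |α| , α∈C)) =
      let open Glue i≤n |γ| γ∈G |α| α∈C in π , |π|≡2n , fromWitness (Cπ , π-centro)
    split∘glue : ∀ x → split (glue x) ≡ x
    split∘glue (i , i≤n , (γ , |γ| , γ∈G) , (α , |α| , α∈C)) =
      let i-eq , γ-eq , α-eq = Glue.split-components i≤n |γ| γ∈G |α| α∈C (proj₂ (lastSplitUpTo (sandwich α γ) n))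
      in Decomposed-≡ i-eq γ-eq α-eq
    glue∘split : ∀ x → glue (split x) ≡ x
    glue∘split (π , |π| , π∈B) = PermsOfSize-≡
      (sym (Split.π≡sandwich |π| (proj₁ (toWitness π∈B)) (proj₂ (toWitness π∈B)) (proj₂ (lastSplitUpTo π n))))

  indecomposable⇔inD : ∀ π → (C π × Centrosymmetric π × SumIndecomposable π) ⇔ T (inD π)
  indecomposable⇔inD π = mk⇔
    (λ (Cπ , centro , indecomposable) →
      fromWitness (Cπ , centro , λ {t} → sumIndecomposable⇒noSplit π indecomposable {t}))
    (λ π∈D → let Cπ , centro , noSplit = toWitness {a? = C? π ×-dec centrosymmetric? π ×-dec noSplit? π} π∈D
             in Cπ , centro , noSplit⇒sumIndecomposable π noSplit)

proposition4p2 :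
    (C : Perm → Set) → IsPermClass C → SumClosed C → RcInvariant C →
    (a b d : ℕ → ℕ) →
    (∀ n → CardOfSize C n (a n)) →
    (∀ n → CardOfSize (λ π → C π × Centrosymmetric π) (2 * n) (b n)) →
    (∀ n → CardOfSize (λ π → C π × Centrosymmetric π × SumIndecomposable π) (2 * suc n) (d (suc n))) →
    ∀ n → b n ≡ (onePlus d ⊛ a) n
proposition4p2 C class sumClosed rcInvariant a b d count-a count-b count-d n =
  card-unique (↔-trans card-B (centrosymmetric-decomposition n)) card-decomposed
  where
  open Decomposition C class sumClosed rcInvariant (decidable-from-count count-a)
  card-A : ∀ k → Card (PermsOfSize inC k) (a k)
  card-A k = card-PermsOfSize inC k (λ _ → ⇔-True _) (count-a k)
  card-B : Card (PermsOfSize inB (2 * n)) (b n)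
  card-B = card-PermsOfSize inB (2 * n) (λ _ → ⇔-True _) (count-b n)
  card-G : ∀ i → Card (PermsOfSize (inG i) (2 * i)) (onePlus d i)
  card-G zero = card-singleton ((0 , []) , refl , tt) λ { ((_ , []) , refl , tt) → refl }
  card-G (suc i) = card-PermsOfSize inD (2 * suc i) indecomposable⇔inD (count-d i)
  card-decomposed : Card (Decomposed n) ((onePlus d ⊛ a) n)
  card-decomposed = card-Σ≤ _ _ n λ {i} _ → card-× (card-G i) (card-A (n ∸ i))
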